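{- For $i\in\{1,2\}$ let $r_i,s_i$ be integers with $s_i\ne0$ and $\alpha_i:=r_i/s_i\notin\mathbb Z_{\le0}$. Let $d:=\operatorname{lcm}(s_1,s_2)$ and let $b$ be an integer with $b>\max\big(|r_1|,|r_2|,d\cdot|\lfloor1-\alpha_1\rfloor-\lfloor1-\alpha_2\rfloor|\big)$. For $i\in\{1,2\}$ set $c_i:=\gcd(r_i,s_i,b)$, assume there is an integer $e_i$ with $1\le e_i\le d$ and $be_i\equiv c_i\pmod{s_i}$, and let $k_i\in\{0,\dots,c_i-1\}$. Let $a$ be a positive integer, and set $$\gamma_i:=\frac{D_{b/c_i}(\alpha_i)+k_i}{c_i}+\frac{\lfloor1-\alpha_i\rfloor}{b},\qquad \Gamma_i:=\frac{\langle e_i\alpha_i\rangle+k_i}{c_i}-\lfloor1-a\alpha_i\rfloor.$$ Then $\gamma_1\le\gamma_2$ if and only if $\Gamma_1\preceq\Gamma_2$. Furthermore, if $\Gamma_1=\Gamma_2$ then $\alpha_1=\alpha_2$.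
   Context: For a positive integer $m$ and a rational $\alpha$ with reduced denominator coprime to $m$, $D_m(\alpha)$ is the unique rational with reduced denominator coprime to $m$ such that $mD_m(\alpha)-\alpha\in\{0,\dots,m-1\}$ (here $D_{b/c_i}(\alpha_i)$ is defined since the hypothesis on $e_i$ forces $\gcd(b,s_i)=c_i$). For real $x$, $\langle x\rangle$ is the fractional part of $x$ if $x\notin\mathbb Z$ and $1$ if $x\in\mathbb Z$. Christol order: $x\preceq y$ iff $\langle x\rangle<\langle y\rangle$, or $\langle x\rangle=\langle y\rangle$ and $x\ge y$. -}

module Defs where

open import Data.Nat as N using (ℕ; zero; suc)
import Data.Nat.DivMod as NDM
open import Data.Nat.Coprimality using (Coprime)
open import Data.Integer as Z using (ℤ; +_; -[1+_]; ∣_∣)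
open import Data.Integer.GCD as ZG using ()
open import Data.Integer.LCM as ZL using ()
open import Data.Rational as Q using (ℚ; ↧ₙ_; floor)
open import Data.Rational.Properties as QP using ()
open import Data.Product using (Σ; _×_)
open import Relation.Nullary using (¬_; yes; no)
open import Relation.Binary.PropositionalEquality using (_≡_)
open import Data.Sum using (_⊎_)

ι : ℤ → ℚ
ι z = z Q./ 1

ιₙ : ℕ → ℚ
ιₙ n = ι (+ n)

-- division of a rational by an integer (junk value 0 when dividing by 0;
-- only used below with nonzero divisors)
_÷ℤ_ : ℚ → ℤ → ℚ
x ÷ℤ (+ zero)  = Q.0ℚ
x ÷ℤ (+ suc n) = x Q.* (+ 1 Q./ suc n)
x ÷ℤ -[1+ n ]  = Q.- (x Q.* (+ 1 Q./ suc n))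

_//_ : ℤ → ℤ → ℚ
r // s = ι r ÷ℤ s

-- natural-number quotient (junk value 0 when dividing by 0)
_quot_ : ℕ → ℕ → ℕ
m quot zero  = zero
m quot suc n = m NDM./ suc n

NonPosInt : ℚ → Set
NonPosInt α = Σ ℕ (λ n → α ≡ Q.- ιₙ n)

-- ⟨x⟩ : fractional part of x if x ∉ ℤ, and 1 if x ∈ ℤ
⟨_⟩ : ℚ → ℚ
⟨ x ⟩ with x Q.- ι (floor x) QP.≟ Q.0ℚ
... | yes _ = Q.1ℚ
... | no  _ = x Q.- ι (floor x)

_≼_ : ℚ → ℚ → Set
x ≼ y = (⟨ x ⟩ Q.< ⟨ y ⟩) ⊎ ((⟨ x ⟩ ≡ ⟨ y ⟩) × (y Q.≤ x))

-- IsD m α δ : δ = D_m(α), i.e. δ is a rational with reduced denominator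
-- coprime to m such that m·δ − α ∈ {0,…,m−1}
IsD : ℕ → ℚ → ℚ → Set
IsD m α δ = Coprime (↧ₙ δ) m × Σ ℕ (λ j → (j N.< m) × (ιₙ m Q.* δ Q.- α ≡ ιₙ j))

{-# OPTIONS --safe #-}
module Submission where

-- Fix an index, put c = c_i, m = b/c and δ = D_m(α).  After cancelling c from r and s, m·(s·δ) = r + j·s
-- with |r| < m, j < m and the denominator of δ prime to m, so s·δ is an integer t with 1 ≤ t ≤ |s|:
-- hence 0 < δ ≤ 1.  As m·e ≡ 1 (mod s), e·α = e·(m·δ - j) ≡ δ modulo ℤ, so ⟨e·α⟩ = δ.  Thus with
-- x = (δ + k)/c ∈ (0,1], f = ⌊1 - α⌋ and F = ⌊1 - a·α⌋ we have γ = x + f/b, Γ = x - F and ⟨Γ⟩ = x,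
-- while d·x and b·x - α are integers.  If x₁ ≠ x₂ they differ by at least 1/d > |f₁ - f₂|/b, so γ
-- and ⟨Γ⟩ are ordered alike.  If x₁ = x₂ then α₁ = α₂ + N with N ∈ ℤ, so f₁ = f₂ - N and F₁ = F₂ - a·N:
-- both γ₁ ≤ γ₂ and Γ₂ ≤ Γ₁ say N ≥ 0, and Γ₁ = Γ₂ says N = 0.

open import Defs
open import Data.Nat as N using (ℕ; zero; suc)
import Data.Nat.Properties as NP
import Data.Nat.Divisibility as ND
import Data.Nat.DivMod as NDM
import Data.Nat.Coprimality as C
import Data.Nat.GCD as NG
import Data.Nat.LCM as NL
open import Data.Integer as Z using (ℤ; +_; -[1+_]; ∣_∣)
import Data.Integer.Properties as ZP
open import Data.Integer.DivMod using (a≡a%n+[a/n]*n; n%d<d)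
open import Data.Integer.GCD using (gcd; gcd[i,j]∣i; gcd[i,j]∣j)
open import Data.Integer.LCM using (lcm; i∣lcm[i,j]; j∣lcm[i,j])
open import Data.Integer.Divisibility using (_∣_)
import Data.Integer.Divisibility.Signed as ZS
open import Data.Integer.Tactic.RingSolver using (solve-∀)
open import Data.Rational as Q using (ℚ; mkℚ; ↥_; ↧_; ↧ₙ_; floor)
import Data.Rational.Properties as QP
import Data.Rational.Unnormalised as U
import Data.Rational.Unnormalised.Properties as UP
open import Data.Rational.Solver using (module +-*-Solver)
open +-*-Solver using (solve; _:+_; _:*_; :-_; _:-_; _:=_; con)
open import Data.Product using (Σ; _×_; _,_; proj₁; proj₂)
open import Data.Sum using (inj₁; inj₂)
open import Data.Empty using (⊥-elim)
open import Function.Base using (_∘_)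
open import Function.Bundles using (Equivalence; _⇔_; mk⇔)
import Function.Properties.Equivalence as ⇔
open import Relation.Nullary using (¬_; yes; no)
open import Relation.Binary.Definitions using (tri<; tri≈; tri>)
open import Relation.Binary.PropositionalEquality

ι-mkℚ : ∀ z → ι z ≡ mkℚ z 0 (C.sym (C.1-coprimeTo ∣ z ∣))
ι-mkℚ z = QP.↥p/↧p≡p (mkℚ z 0 (C.sym (C.1-coprimeTo ∣ z ∣)))

ι-+ : ∀ i j → ι (i Z.+ j) ≡ ι i Q.+ ι j
ι-+ i j rewrite ι-mkℚ i | ι-mkℚ j =
  cong ι (sym (cong₂ Z._+_ (ZP.*-identityʳ i) (ZP.*-identityʳ j)))

ι-* : ∀ i j → ι (i Z.* j) ≡ ι i Q.* ι j
ι-* i j rewrite ι-mkℚ i | ι-mkℚ j = refl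

ι-neg : ∀ i → ι (Z.- i) ≡ Q.- ι i
ι-neg i rewrite ι-mkℚ i | ι-mkℚ (Z.- i) with i
... | + zero   = refl
... | + suc n  = refl
... | -[1+ n ] = refl

ι-minus : ∀ i j → ι (i Z.- j) ≡ ι i Q.- ι j
ι-minus i j = trans (ι-+ i (Z.- j)) (cong (ι i Q.+_) (ι-neg j))

ι-mono-≤ : ∀ {i j} → i Z.≤ j → ι i Q.≤ ι j
ι-mono-≤ {i} {j} i≤j rewrite ι-mkℚ i | ι-mkℚ j =
  Q.*≤* (subst₂ Z._≤_ (sym (ZP.*-identityʳ i)) (sym (ZP.*-identityʳ j)) i≤j)

ι-cancel-≤ : ∀ {i j} → ι i Q.≤ ι j → i Z.≤ j
ι-cancel-≤ {i} {j} le rewrite ι-mkℚ i | ι-mkℚ j with le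
... | Q.*≤* i≤j = subst₂ Z._≤_ (ZP.*-identityʳ i) (ZP.*-identityʳ j) i≤j

ι-mono-< : ∀ {i j} → i Z.< j → ι i Q.< ι j
ι-mono-< {i} {j} i<j rewrite ι-mkℚ i | ι-mkℚ j =
  Q.*<* (subst₂ Z._<_ (sym (ZP.*-identityʳ i)) (sym (ZP.*-identityʳ j)) i<j)

ι-cancel-< : ∀ {i j} → ι i Q.< ι j → i Z.< j
ι-cancel-< {i} {j} lt rewrite ι-mkℚ i | ι-mkℚ j with lt
... | Q.*<* i<j = subst₂ Z._<_ (ZP.*-identityʳ i) (ZP.*-identityʳ j) i<j

ι-injective : ∀ {i j} → ι i ≡ ι j → i ≡ j
ι-injective eq = ZP.≤-antisym (ι-cancel-≤ (QP.≤-reflexive eq)) (ι-cancel-≤ (QP.≤-reflexive (sym eq)))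

Integral : ℚ → Set
Integral q = Σ ℤ (λ z → q ≡ ι z)

<+1⇒≤ : ∀ {i j} → i Z.< j Z.+ + 1 → i Z.≤ j
<+1⇒≤ {i} {j} lt = subst₂ Z._≤_ (cancel i) (cancel′ j)
  (ZP.+-monoʳ-≤ (Z.- + 1) (ZP.i<j⇒suc[i]≤j lt))
  where
  cancel : ∀ i → Z.- + 1 Z.+ (+ 1 Z.+ i) ≡ i
  cancel = solve-∀
  cancel′ : ∀ j → Z.- + 1 Z.+ (j Z.+ + 1) ≡ j
  cancel′ = solve-∀

floor-≤ : ∀ p → ι (floor p) Q.≤ p
floor-≤ (mkℚ n d _) rewrite ι-mkℚ (n Z./ + suc d) = Q.*≤* (begin
  (n Z./ + suc d) Z.* + suc d                        ≤⟨ ZP.i≤j+i _ (+ (n Z.% + suc d)) ⟩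
  + (n Z.% + suc d) Z.+ (n Z./ + suc d) Z.* + suc d  ≡⟨ a≡a%n+[a/n]*n n (+ suc d) ⟨
  n                                                  ≡⟨ ZP.*-identityʳ n ⟨
  n Z.* + 1                                          ∎)
  where open ZP.≤-Reasoning

floor-< : ∀ p → p Q.< ι (floor p Z.+ + 1)
floor-< (mkℚ n d _) rewrite ι-mkℚ ((n Z./ + suc d) Z.+ + 1) = Q.*<* (begin-strict
  n Z.* + 1                                          ≡⟨ ZP.*-identityʳ n ⟩
  n                                                  ≡⟨ a≡a%n+[a/n]*n n (+ suc d) ⟩
  + (n Z.% + suc d) Z.+ (n Z./ + suc d) Z.* + suc d  <⟨ ZP.+-monoˡ-< ((n Z./ + suc d) Z.* + suc d) (Z.+<+ (n%d<d n (+ suc d))) ⟩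
  + suc d Z.+ (n Z./ + suc d) Z.* + suc d            ≡⟨ distrib (n Z./ + suc d) (+ suc d) ⟩
  ((n Z./ + suc d) Z.+ + 1) Z.* + suc d              ∎)
  where
  open ZP.≤-Reasoning
  distrib : ∀ q e → e Z.+ q Z.* e ≡ (q Z.+ + 1) Z.* e
  distrib = solve-∀

floor-unique : ∀ z p → ι z Q.≤ p → p Q.< ι (z Z.+ + 1) → floor p ≡ z
floor-unique z p z≤p p<z+1 = ZP.≤-antisym
  (<+1⇒≤ (ι-cancel-< (QP.≤-<-trans (floor-≤ p) p<z+1)))
  (<+1⇒≤ (ι-cancel-< (QP.≤-<-trans z≤p (floor-< p))))

floor-+ι : ∀ p n → floor (p Q.+ ι n) ≡ floor p Z.+ n
floor-+ι p n = floor-unique (floor p Z.+ n) (p Q.+ ι n)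
  (subst (Q._≤ p Q.+ ι n) (sym (ι-+ (floor p) n)) (QP.+-monoˡ-≤ (ι n) (floor-≤ p)))
  (subst (p Q.+ ι n Q.<_) (trans (sym (ι-+ (floor p Z.+ + 1) n)) (cong ι (swap (floor p) n)))
    (QP.+-monoˡ-< (ι n) (floor-< p)))
  where
  swap : ∀ f n → f Z.+ + 1 Z.+ n ≡ f Z.+ n Z.+ + 1
  swap = solve-∀

floor-ι : ∀ z → floor (ι z) ≡ z
floor-ι z = floor-unique z (ι z) QP.≤-refl (ι-mono-< {z} (ZP.suc[i]≤j⇒i<j (ZP.≤-reflexive (ZP.+-comm (+ 1) z))))

⟨ι⟩≡1 : ∀ z → ⟨ ι z ⟩ ≡ Q.1ℚ
⟨ι⟩≡1 z with ι z Q.- ι (floor (ι z)) QP.≟ Q.0ℚ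
... | yes _  = refl
... | no ≢0 = ⊥-elim (≢0 (trans (cong (λ w → ι z Q.- ι w) (floor-ι z)) (QP.+-inverseʳ (ι z))))

+ι-minus-floor : ∀ δ n → Q.0ℚ Q.≤ δ → δ Q.< Q.1ℚ → (δ Q.+ ι n) Q.- ι (floor (δ Q.+ ι n)) ≡ δ
+ι-minus-floor δ n 0≤δ δ<1 = begin
  (δ Q.+ ι n) Q.- ι (floor (δ Q.+ ι n)) ≡⟨ cong (λ w → (δ Q.+ ι n) Q.- ι w) (floor-unique n _ n≤ <n+1) ⟩
  (δ Q.+ ι n) Q.- ι n                   ≡⟨ cancel δ (ι n) ⟩
  δ                                     ∎
  where
  open ≡-Reasoning
  n≤ : ι n Q.≤ δ Q.+ ι n
  n≤ = subst (Q._≤ δ Q.+ ι n) (QP.+-identityˡ (ι n)) (QP.+-monoˡ-≤ (ι n) 0≤δ)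
  <n+1 : δ Q.+ ι n Q.< ι (n Z.+ + 1)
  <n+1 = subst (δ Q.+ ι n Q.<_) (sym (trans (ι-+ n (+ 1)) (QP.+-comm (ι n) Q.1ℚ))) (QP.+-monoˡ-< (ι n) δ<1)
  cancel : ∀ d x → d Q.+ x Q.- x ≡ d
  cancel = solve 2 (λ d x → d :+ x :- x := d) refl

⟨+ι⟩-<1 : ∀ δ n → Q.0ℚ Q.< δ → δ Q.< Q.1ℚ → ⟨ δ Q.+ ι n ⟩ ≡ δ
⟨+ι⟩-<1 δ n 0<δ δ<1 with (δ Q.+ ι n) Q.- ι (floor (δ Q.+ ι n)) QP.≟ Q.0ℚ
... | yes ≡0 = ⊥-elim (QP.<⇒≢ 0<δ (trans (sym ≡0) (+ι-minus-floor δ n (QP.<⇒≤ 0<δ) δ<1)))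
... | no _   = +ι-minus-floor δ n (QP.<⇒≤ 0<δ) δ<1

⟨+ι⟩ : ∀ δ n → Q.0ℚ Q.< δ → δ Q.≤ Q.1ℚ → ⟨ δ Q.+ ι n ⟩ ≡ δ
⟨+ι⟩ δ n 0<δ δ≤1 with QP.<-cmp δ Q.1ℚ
... | tri< δ<1 _ _  = ⟨+ι⟩-<1 δ n 0<δ δ<1
... | tri≈ _ refl _ = trans (cong ⟨_⟩ (sym (ι-+ (+ 1) n))) (⟨ι⟩≡1 (+ 1 Z.+ n))
... | tri> _ _ δ>1  = ⊥-elim (QP.<-irrefl refl (QP.<-≤-trans δ>1 δ≤1))

⟨-ι⟩ : ∀ x z → Q.0ℚ Q.< x → x Q.≤ Q.1ℚ → ⟨ x Q.- ι z ⟩ ≡ x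
⟨-ι⟩ x z 0<x x≤1 = trans (cong (λ w → ⟨ x Q.+ w ⟩) (sym (ι-neg z))) (⟨+ι⟩ x (Z.- z) 0<x x≤1)

1/n*n≡1 : ∀ n → (+ 1 Q./ suc n) Q.* ι (+ suc n) ≡ Q.1ℚ
1/n*n≡1 n rewrite QP.↥p/↧p≡p (mkℚ (+ 1) n (C.1-coprimeTo (suc n))) | ι-mkℚ (+ suc n) =
  QP.*-inverseˡ (mkℚ (+ suc n) 0 (C.sym (C.1-coprimeTo (suc n))))

*[1/n*n]≡id : ∀ y n → y Q.* ((+ 1 Q./ suc n) Q.* ι (+ suc n)) ≡ y
*[1/n*n]≡id y n = trans (cong (y Q.*_) (1/n*n≡1 n)) (QP.*-identityʳ y)

÷ℤ-*-cancel : ∀ y w → w ≢ + 0 → (y ÷ℤ w) Q.* ι w ≡ y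
÷ℤ-*-cancel y (+ zero)  w≢0 = ⊥-elim (w≢0 refl)
÷ℤ-*-cancel y (+ suc n) _   = trans (QP.*-assoc y _ _) (*[1/n*n]≡id y n)
÷ℤ-*-cancel y -[1+ n ]  _   = begin
  Q.- (y Q.* i) Q.* ι -[1+ n ]       ≡⟨ cong (Q.- (y Q.* i) Q.*_) (ι-neg (+ suc n)) ⟩
  Q.- (y Q.* i) Q.* Q.- ι (+ suc n)  ≡⟨ reassoc y i (ι (+ suc n)) ⟩
  y Q.* (i Q.* ι (+ suc n))          ≡⟨ *[1/n*n]≡id y n ⟩
  y                                  ∎
  where
  open ≡-Reasoning
  i : ℚ
  i = + 1 Q./ suc n
  reassoc : ∀ y i n → Q.- (y Q.* i) Q.* Q.- n ≡ y Q.* (i Q.* n)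
  reassoc = solve 3 (λ y i n → :- (y :* i) :* :- n := y :* (i :* n)) refl

*-÷ℤ-cancel : ∀ y w → w ≢ + 0 → (y Q.* ι w) ÷ℤ w ≡ y
*-÷ℤ-cancel y (+ zero)  w≢0 = ⊥-elim (w≢0 refl)
*-÷ℤ-cancel y (+ suc n) _   = trans (reassoc y (ι (+ suc n)) _) (*[1/n*n]≡id y n)
  where
  reassoc : ∀ y n i → y Q.* n Q.* i ≡ y Q.* (i Q.* n)
  reassoc = solve 3 (λ y n i → y :* n :* i := y :* (i :* n)) refl
*-÷ℤ-cancel y -[1+ n ]  _   = begin
  Q.- (y Q.* ι -[1+ n ] Q.* i)       ≡⟨ cong (λ w → Q.- (y Q.* w Q.* i)) (ι-neg (+ suc n)) ⟩
  Q.- (y Q.* Q.- ι (+ suc n) Q.* i)  ≡⟨ reassoc y (ι (+ suc n)) i ⟩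
  y Q.* (i Q.* ι (+ suc n))          ≡⟨ *[1/n*n]≡id y n ⟩
  y                                  ∎
  where
  open ≡-Reasoning
  i : ℚ
  i = + 1 Q./ suc n
  reassoc : ∀ y n i → Q.- (y Q.* Q.- n Q.* i) ≡ y Q.* (i Q.* n)
  reassoc = solve 3 (λ y n i → :- (y :* :- n :* i) := y :* (i :* n)) refl

*ι-cancel : ∀ w {y z} → w ≢ + 0 → y Q.* ι w ≡ z Q.* ι w → y ≡ z
*ι-cancel w {y} {z} w≢0 eq = begin
  y                  ≡⟨ *-÷ℤ-cancel y w w≢0 ⟨
  (y Q.* ι w) ÷ℤ w   ≡⟨ cong (_÷ℤ w) eq ⟩
  (z Q.* ι w) ÷ℤ w   ≡⟨ *-÷ℤ-cancel z w w≢0 ⟩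
  z                  ∎
  where open ≡-Reasoning

ι↧*≡ι↥ : ∀ δ → ι (↧ δ) Q.* δ ≡ ι (↥ δ)
ι↧*≡ι↥ (mkℚ n d c) rewrite ι-mkℚ (+ suc d) | ι-mkℚ n =
  QP.toℚᵘ-injective (UP.≃-trans (QP.toℚᵘ-homo-* (mkℚ (+ suc d) 0 (C.sym (C.1-coprimeTo (suc d)))) (mkℚ n d c))
                                (U.*≡* cross))
  where
  cross : (+ suc d Z.* n) Z.* + 1 ≡ n Z.* + suc (d N.+ 0)
  cross rewrite NP.+-identityʳ d = trans (ZP.*-identityʳ _) (ZP.*-comm (+ suc d) n)

-- The denominator D of δ divides m·s·N, N the numerator, and is coprime to m and to N; so D ∣ s.
coprime-den⇒integral : ∀ m s δ z → C.Coprime (↧ₙ δ) m → ι (+ m) Q.* (ι s Q.* δ) ≡ ι z → Integral (ι s Q.* δ)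
coprime-den⇒integral m s δ@(mkℚ n d coprime) z den⊥m m*s*δ≡z = u Z.* n , (begin
  ι s Q.* δ                 ≡⟨ cong (λ w → ι w Q.* δ) (ZS._∣_.equality D∣s) ⟩
  ι (u Z.* + D) Q.* δ       ≡⟨ cong (Q._* δ) (ι-* u (+ D)) ⟩
  ι u Q.* ι (+ D) Q.* δ     ≡⟨ QP.*-assoc (ι u) (ι (+ D)) δ ⟩
  ι u Q.* (ι (+ D) Q.* δ)   ≡⟨ cong (ι u Q.*_) (ι↧*≡ι↥ δ) ⟩
  ι u Q.* ι n               ≡⟨ ι-* u n ⟨
  ι (u Z.* n)               ∎)
  where
  open ≡-Reasoning
  D : ℕ
  D = suc d
  m*s*n≡D*z : + m Z.* s Z.* n ≡ + D Z.* z
  m*s*n≡D*z = ι-injective (begin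
    ι (+ m Z.* s Z.* n)                      ≡⟨ trans (ι-* (+ m Z.* s) n) (cong (Q._* ι n) (ι-* (+ m) s)) ⟩
    ι (+ m) Q.* ι s Q.* ι n                  ≡⟨ cong (ι (+ m) Q.* ι s Q.*_) (ι↧*≡ι↥ δ) ⟨
    ι (+ m) Q.* ι s Q.* (ι (+ D) Q.* δ)      ≡⟨ reassoc (ι (+ D)) (ι (+ m)) (ι s) δ ⟩
    ι (+ D) Q.* (ι (+ m) Q.* (ι s Q.* δ))    ≡⟨ cong (ι (+ D) Q.*_) m*s*δ≡z ⟩
    ι (+ D) Q.* ι z                          ≡⟨ ι-* (+ D) z ⟨
    ι (+ D Z.* z)                            ∎)
    where
    reassoc : ∀ D m s δ → m Q.* s Q.* (D Q.* δ) ≡ D Q.* (m Q.* (s Q.* δ))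
    reassoc = solve 4 (λ D m s δ → m :* s :* (D :* δ) := D :* (m :* (s :* δ))) refl
  D∣m*[s*n] : D ND.∣ m N.* (∣ s ∣ N.* ∣ n ∣)
  D∣m*[s*n] = ND.divides ∣ z ∣ (begin
    m N.* (∣ s ∣ N.* ∣ n ∣)   ≡⟨ NP.*-assoc m ∣ s ∣ ∣ n ∣ ⟨
    m N.* ∣ s ∣ N.* ∣ n ∣     ≡⟨ trans (ZP.abs-* (+ m Z.* s) n) (cong (N._* ∣ n ∣) (ZP.abs-* (+ m) s)) ⟨
    ∣ + m Z.* s Z.* n ∣       ≡⟨ cong ∣_∣ m*s*n≡D*z ⟩
    ∣ + D Z.* z ∣             ≡⟨ trans (ZP.abs-* (+ D) z) (NP.*-comm D ∣ z ∣) ⟩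
    ∣ z ∣ N.* D               ∎)
  D∣s : + D ZS.∣ s
  D∣s = ZS.∣ᵤ⇒∣ (C.coprime-divisor (C.sym (C.recompute coprime))
                  (subst (D ND.∣_) (NP.*-comm ∣ s ∣ ∣ n ∣) (C.coprime-divisor den⊥m D∣m*[s*n])))
  u : ℤ
  u = ZS._∣_.quotient D∣s

∣r∣<m⇒-m<r : ∀ m' r → + ∣ r ∣ Z.< + suc m' → Z.- + suc m' Z.< r
∣r∣<m⇒-m<r m' (+ n)    _                   = Z.-<+
∣r∣<m⇒-m<r m' -[1+ n ] (Z.+<+ (N.s≤s n<m)) = Z.-<- n<m

∣r∣<m⇒r<m : ∀ m' r → + ∣ r ∣ Z.< + suc m' → r Z.< + suc m'
∣r∣<m⇒r<m m' (+ n)    n<m = n<m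
∣r∣<m⇒r<m m' -[1+ n ] _   = Z.-<+

m*t≡r+j*s⇒1≤t : ∀ m' r t p j → + ∣ r ∣ Z.< + suc m' → t ≢ + 0 →
  + suc m' Z.* t ≡ r Z.+ + j Z.* + suc p → + 1 Z.≤ t
m*t≡r+j*s⇒1≤t m' r (+ zero)  p j _    t≢0 _  = ⊥-elim (t≢0 refl)
m*t≡r+j*s⇒1≤t m' r (+ suc _) p j _    _   _  = Z.+≤+ (N.s≤s N.z≤n)
m*t≡r+j*s⇒1≤t m' r -[1+ u ]  p j |r|<m _ eq = ⊥-elim (ZP.<-irrefl refl (begin-strict
  Z.- m                      <⟨ ∣r∣<m⇒-m<r m' r |r|<m ⟩
  r                          ≤⟨ ZP.i≤i+j r (+ (j N.* suc p)) ⟩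
  r Z.+ + (j N.* suc p)      ≡⟨ cong (λ w → r Z.+ w) (ZP.pos-* j (suc p)) ⟩
  r Z.+ + j Z.* + suc p      ≡⟨ eq ⟨
  m Z.* -[1+ u ]             ≤⟨ ZP.*-monoˡ-≤-nonNeg m (Z.-≤- N.z≤n) ⟩
  m Z.* Z.- + 1              ≡⟨ trans (ZP.*-comm m (Z.- + 1)) (ZP.-1*i≡-i m) ⟩
  Z.- m                      ∎))
  where
  open ZP.≤-Reasoning
  m : ℤ
  m = + suc m'

m*t≡r+j*s⇒t≤s : ∀ m' r t p j → + ∣ r ∣ Z.< + suc m' → j N.< suc m' →
  + suc m' Z.* t ≡ r Z.+ + j Z.* + suc p → t Z.≤ + suc p
m*t≡r+j*s⇒t≤s m' r t p j |r|<m j<m eq = ZP.≮⇒≥ s≮t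
  where
  open ZP.≤-Reasoning
  m s : ℤ
  m = + suc m'
  s = + suc p
  s≮t : ¬ (s Z.< t)
  s≮t s<t = ZP.<-irrefl refl (begin-strict
    m Z.* (+ 1 Z.+ s)    ≤⟨ ZP.*-monoˡ-≤-nonNeg m (ZP.i<j⇒suc[i]≤j s<t) ⟩
    m Z.* t              ≡⟨ eq ⟩
    r Z.+ + j Z.* s      <⟨ ZP.+-mono-<-≤ (∣r∣<m⇒r<m m' r |r|<m) (ZP.*-monoʳ-≤-nonNeg s (Z.+≤+ (NP.<⇒≤ j<m))) ⟩
    m Z.+ m Z.* s        ≡⟨ distrib m s ⟨
    m Z.* (+ 1 Z.+ s)    ∎)
    where
    distrib : ∀ m s → m Z.* (+ 1 Z.+ s) ≡ m Z.+ m Z.* s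
    distrib = solve-∀

t≤P⇒0<δ≤1 : ∀ P t δ → + 1 Z.≤ t → t Z.≤ P → ι P Q.* δ ≡ ι t → (Q.0ℚ Q.< δ) × (δ Q.≤ Q.1ℚ)
t≤P⇒0<δ≤1 P t δ 1≤t t≤P P*δ≡t = 0<δ , δ≤1
  where
  0<P : Q.0ℚ Q.< ι P
  0<P = ι-mono-< (ZP.<-≤-trans (Z.+<+ (N.s≤s N.z≤n)) (ZP.≤-trans 1≤t t≤P))
  0<δ : Q.0ℚ Q.< δ
  0<δ = QP.*-cancelˡ-<-nonNeg (ι P) {{Q.nonNegative (QP.<⇒≤ 0<P)}}
          (subst₂ Q._<_ (sym (QP.*-zeroʳ (ι P))) (sym P*δ≡t) (ι-mono-< (ZP.<-≤-trans (Z.+<+ (N.s≤s N.z≤n)) 1≤t)))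
  δ≤1 : δ Q.≤ Q.1ℚ
  δ≤1 = QP.*-cancelˡ-≤-pos (ι P) {{Q.positive 0<P}}
          (subst₂ Q._≤_ (sym P*δ≡t) (sym (QP.*-identityʳ (ι P))) (ι-mono-≤ t≤P))

m*t≡r+j*s⇒0<δ≤1 : ∀ m' r s t j δ → + ∣ r ∣ Z.< + suc m' → j N.< suc m' → t ≢ + 0 →
  + suc m' Z.* t ≡ r Z.+ + j Z.* s → ι s Q.* δ ≡ ι t → (Q.0ℚ Q.< δ) × (δ Q.≤ Q.1ℚ)
m*t≡r+j*s⇒0<δ≤1 m' r (+ zero) t j δ _ _ t≢0 _ s*δ≡t =
  ⊥-elim (t≢0 (ι-injective (trans (sym s*δ≡t) (QP.*-zeroˡ δ))))
m*t≡r+j*s⇒0<δ≤1 m' r (+ suc p) t j δ |r|<m j<m t≢0 eq s*δ≡t =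
  t≤P⇒0<δ≤1 (+ suc p) t δ (m*t≡r+j*s⇒1≤t m' r t p j |r|<m t≢0 eq) (m*t≡r+j*s⇒t≤s m' r t p j |r|<m j<m eq) s*δ≡t
m*t≡r+j*s⇒0<δ≤1 m' r -[1+ p ] t j δ |r|<m j<m t≢0 eq s*δ≡t =
  t≤P⇒0<δ≤1 (+ suc p) (Z.- t) δ
    (m*t≡r+j*s⇒1≤t m' (Z.- r) (Z.- t) p j |-r|<m (t≢0 ∘ ZP.neg-injective) eq′)
    (m*t≡r+j*s⇒t≤s m' (Z.- r) (Z.- t) p j |-r|<m j<m eq′)
    (begin
      ι (+ suc p) Q.* δ            ≡⟨ double-neg (ι (+ suc p)) δ ⟩
      Q.- (Q.- ι (+ suc p) Q.* δ)  ≡⟨ cong (λ w → Q.- (w Q.* δ)) (ι-neg (+ suc p)) ⟨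
      Q.- (ι -[1+ p ] Q.* δ)       ≡⟨ cong Q.-_ s*δ≡t ⟩
      Q.- ι t                      ≡⟨ ι-neg t ⟨
      ι (Z.- t)                    ∎)
  where
  open ≡-Reasoning
  double-neg : ∀ P δ → P Q.* δ ≡ Q.- (Q.- P Q.* δ)
  double-neg = solve 2 (λ P δ → P :* δ := :- (:- P :* δ)) refl
  |-r|<m : + ∣ Z.- r ∣ Z.< + suc m'
  |-r|<m = subst (λ n → + n Z.< + suc m') (sym (ZP.∣-i∣≡∣i∣ r)) |r|<m
  eq′ : + suc m' Z.* Z.- t ≡ Z.- r Z.+ + j Z.* + suc p
  eq′ = trans (neg-outside (+ suc m') t) (trans (cong Z.-_ eq) (neg-inside r (+ j) (+ suc p)))
    where
    neg-outside : ∀ m t → m Z.* Z.- t ≡ Z.- (m Z.* t)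
    neg-outside = solve-∀
    neg-inside : ∀ r j P → Z.- (r Z.+ j Z.* Z.- P) ≡ Z.- r Z.+ j Z.* P
    neg-inside = solve-∀

record Admissible (b s : ℤ) (α x : ℚ) : Set where
  field
    0<x            : Q.0ℚ Q.< x
    x≤1            : x Q.≤ Q.1ℚ
    x*s-integral   : Integral (x Q.* ι s)
    b*x-α-integral : Integral (ι b Q.* x Q.- α)

module D-analysis (m' : ℕ) {α : ℚ} {r s : ℤ} (s≢0 : s ≢ + 0) (α*s≡r : α Q.* ι s ≡ ι r) (|r|<m : + ∣ r ∣ Z.< + suc m')
                  (α∉ℤ≤0 : ¬ NonPosInt α) {δ : ℚ} (δ≡D[α] : IsD (suc m') α δ) where

  m : ℕ
  m = suc m'

  j : ℕ
  j = proj₁ (proj₂ δ≡D[α])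

  j<m : j N.< m
  j<m = proj₁ (proj₂ (proj₂ δ≡D[α]))

  m*δ-α≡j : ιₙ m Q.* δ Q.- α ≡ ιₙ j
  m*δ-α≡j = proj₂ (proj₂ (proj₂ δ≡D[α]))

  m*δ≡α+j : ιₙ m Q.* δ ≡ α Q.+ ιₙ j
  m*δ≡α+j = trans (split (ιₙ m Q.* δ) α) (cong (α Q.+_) m*δ-α≡j)
    where
    split : ∀ x a → x ≡ a Q.+ (x Q.- a)
    split = solve 2 (λ x a → x := a :+ (x :- a)) refl

  α≡m*δ-j : α ≡ ιₙ m Q.* δ Q.- ιₙ j
  α≡m*δ-j = trans (sym (cancel (ιₙ m Q.* δ) α)) (cong (λ w → ιₙ m Q.* δ Q.- w) m*δ-α≡j)
    where
    cancel : ∀ x a → x Q.- (x Q.- a) ≡ a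
    cancel = solve 2 (λ x a → x :- (x :- a) := a) refl

  m*[s*δ]≡r+j*s : ιₙ m Q.* (ι s Q.* δ) ≡ ι (r Z.+ + j Z.* s)
  m*[s*δ]≡r+j*s = begin
    ιₙ m Q.* (ι s Q.* δ)         ≡⟨ reassoc (ιₙ m) (ι s) δ ⟩
    ιₙ m Q.* δ Q.* ι s           ≡⟨ cong (Q._* ι s) m*δ≡α+j ⟩
    (α Q.+ ιₙ j) Q.* ι s         ≡⟨ QP.*-distribʳ-+ (ι s) α (ιₙ j) ⟩
    α Q.* ι s Q.+ ιₙ j Q.* ι s   ≡⟨ cong₂ Q._+_ α*s≡r (sym (ι-* (+ j) s)) ⟩
    ι r Q.+ ι (+ j Z.* s)        ≡⟨ ι-+ r (+ j Z.* s) ⟨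
    ι (r Z.+ + j Z.* s)          ∎
    where
    open ≡-Reasoning
    reassoc : ∀ m s δ → m Q.* (s Q.* δ) ≡ m Q.* δ Q.* s
    reassoc = solve 3 (λ m s δ → m :* (s :* δ) := m :* δ :* s) refl

  s*δ-integral : Integral (ι s Q.* δ)
  s*δ-integral = coprime-den⇒integral m s δ (r Z.+ + j Z.* s) (proj₁ δ≡D[α]) m*[s*δ]≡r+j*s

  t : ℤ
  t = proj₁ s*δ-integral

  s*δ≡t : ι s Q.* δ ≡ ι t
  s*δ≡t = proj₂ s*δ-integral

  m*t≡r+j*s : + m Z.* t ≡ r Z.+ + j Z.* s
  m*t≡r+j*s = ι-injective (trans (ι-* (+ m) t) (trans (cong (ιₙ m Q.*_) (sym s*δ≡t)) m*[s*δ]≡r+j*s))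

  t≢0 : t ≢ + 0
  t≢0 t≡0 = α∉ℤ≤0 (j , (begin
    α                            ≡⟨ α≡m*δ-j ⟩
    ιₙ m Q.* δ Q.- ιₙ j          ≡⟨ cong (λ w → w Q.- ιₙ j) m*δ≡0 ⟩
    Q.0ℚ Q.- ιₙ j                ≡⟨ QP.+-identityˡ (Q.- ιₙ j) ⟩
    Q.- ιₙ j                     ∎))
    where
    open ≡-Reasoning
    δ≡0 : δ ≡ Q.0ℚ
    δ≡0 = *ι-cancel s s≢0 (trans (QP.*-comm δ (ι s)) (trans s*δ≡t (trans (cong ι t≡0) (sym (QP.*-zeroˡ (ι s))))))
    m*δ≡0 : ιₙ m Q.* δ ≡ Q.0ℚ
    m*δ≡0 = trans (cong (ιₙ m Q.*_) δ≡0) (QP.*-zeroʳ (ιₙ m))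

  0<δ≤1 : (Q.0ℚ Q.< δ) × (δ Q.≤ Q.1ℚ)
  0<δ≤1 = m*t≡r+j*s⇒0<δ≤1 m' r s t j δ |r|<m j<m t≢0 m*t≡r+j*s s*δ≡t

  0<δ : Q.0ℚ Q.< δ
  0<δ = proj₁ 0<δ≤1

  δ≤1 : δ Q.≤ Q.1ℚ
  δ≤1 = proj₂ 0<δ≤1

  ⟨e*α⟩≡δ : ∀ e → s ZS.∣ (+ m Z.* e Z.- + 1) → ⟨ ι e Q.* α ⟩ ≡ δ
  ⟨e*α⟩≡δ e s∣m*e-1 = trans (cong ⟨_⟩ e*α≡δ+n) (⟨+ι⟩ δ (Y Z.* t Z.- e Z.* + j) 0<δ δ≤1)
    where
    open ≡-Reasoning
    Y : ℤ
    Y = ZS._∣_.quotient s∣m*e-1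
    m*e≡Y*s+1 : ιₙ m Q.* ι e ≡ ι Y Q.* ι s Q.+ Q.1ℚ
    m*e≡Y*s+1 = begin
      ιₙ m Q.* ι e                     ≡⟨ ι-* (+ m) e ⟨
      ι (+ m Z.* e)                    ≡⟨ cong ι (add-back (+ m Z.* e)) ⟩
      ι (+ m Z.* e Z.- + 1 Z.+ + 1)    ≡⟨ cong (λ w → ι (w Z.+ + 1)) (ZS._∣_.equality s∣m*e-1) ⟩
      ι (Y Z.* s Z.+ + 1)              ≡⟨ trans (ι-+ (Y Z.* s) (+ 1)) (cong (Q._+ Q.1ℚ) (ι-* Y s)) ⟩
      ι Y Q.* ι s Q.+ Q.1ℚ             ∎
      where
      add-back : ∀ x → x ≡ x Z.- + 1 Z.+ + 1
      add-back = solve-∀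
    e*α≡δ+n : ι e Q.* α ≡ δ Q.+ ι (Y Z.* t Z.- e Z.* + j)
    e*α≡δ+n = begin
      ι e Q.* α                                          ≡⟨ cong (ι e Q.*_) α≡m*δ-j ⟩
      ι e Q.* (ιₙ m Q.* δ Q.- ιₙ j)                      ≡⟨ expand (ι e) (ιₙ m) δ (ιₙ j) ⟩
      ιₙ m Q.* ι e Q.* δ Q.- ι e Q.* ιₙ j                ≡⟨ cong (λ w → w Q.* δ Q.- ι e Q.* ιₙ j) m*e≡Y*s+1 ⟩
      (ι Y Q.* ι s Q.+ Q.1ℚ) Q.* δ Q.- ι e Q.* ιₙ j      ≡⟨ regroup (ι Y) (ι s) δ (ι e) (ιₙ j) ⟩
      δ Q.+ (ι Y Q.* (ι s Q.* δ) Q.- ι e Q.* ιₙ j)       ≡⟨ cong (λ w → δ Q.+ (ι Y Q.* w Q.- ι e Q.* ιₙ j)) s*δ≡t ⟩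
      δ Q.+ (ι Y Q.* ι t Q.- ι e Q.* ιₙ j)               ≡⟨ cong (δ Q.+_) (trans (ι-minus (Y Z.* t) (e Z.* + j))
                                                              (cong₂ Q._-_ (ι-* Y t) (ι-* e (+ j)))) ⟨
      δ Q.+ ι (Y Z.* t Z.- e Z.* + j)                    ∎
      where
      expand : ∀ e m δ j → e Q.* (m Q.* δ Q.- j) ≡ m Q.* e Q.* δ Q.- e Q.* j
      expand = solve 4 (λ e m δ j → e :* (m :* δ :- j) := m :* e :* δ :- e :* j) refl
      regroup : ∀ Y s δ e j → (Y Q.* s Q.+ Q.1ℚ) Q.* δ Q.- e Q.* j ≡ δ Q.+ (Y Q.* (s Q.* δ) Q.- e Q.* j)
      regroup = solve 5 (λ Y s δ e j → (Y :* s :+ con Q.1ℚ) :* δ :- e :* j := δ :+ (Y :* (s :* δ) :- e :* j)) refl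

  shifted-admissible : ∀ c' k → k N.< suc c' →
    Admissible (+ suc c' Z.* + m) (s Z.* + suc c') α ((δ Q.+ ιₙ k) ÷ℤ (+ suc c'))
  shifted-admissible c' k k<c = record
    { 0<x            = QP.*-cancelʳ-<-nonNeg (ι c) {{Q.nonNegative (QP.<⇒≤ 0<c)}}
                         (subst₂ Q._<_ (sym (QP.*-zeroˡ (ι c))) (sym x*c≡δ+k)
                           (QP.+-mono-<-≤ 0<δ (ι-mono-≤ {+ 0} {+ k} (Z.+≤+ N.z≤n))))
    ; x≤1            = QP.*-cancelʳ-≤-pos (ι c) {{Q.positive 0<c}}
                         (subst₂ Q._≤_ (sym x*c≡δ+k) (sym (QP.*-identityˡ (ι c))) δ+k≤c)
    ; x*s-integral   = t Z.+ + k Z.* s , x*[s*c]≡t+k*s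
    ; b*x-α-integral = + j Z.+ + m Z.* + k , c*m*x-α≡j+m*k
    }
    where
    open ≡-Reasoning
    c : ℤ
    c = + suc c'
    x : ℚ
    x = (δ Q.+ ιₙ k) ÷ℤ c
    0<c : Q.0ℚ Q.< ι c
    0<c = ι-mono-< {+ 0} {c} (Z.+<+ (N.s≤s N.z≤n))
    x*c≡δ+k : x Q.* ι c ≡ δ Q.+ ιₙ k
    x*c≡δ+k = ÷ℤ-*-cancel (δ Q.+ ιₙ k) c (λ ())
    δ+k≤c : δ Q.+ ιₙ k Q.≤ ι c
    δ+k≤c = QP.≤-trans (QP.+-monoˡ-≤ (ιₙ k) δ≤1)
              (subst (Q._≤ ι c) (ι-+ (+ 1) (+ k)) (ι-mono-≤ (ZP.i<j⇒suc[i]≤j (Z.+<+ k<c))))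
    x*[s*c]≡t+k*s : x Q.* ι (s Z.* c) ≡ ι (t Z.+ + k Z.* s)
    x*[s*c]≡t+k*s = begin
      x Q.* ι (s Z.* c)               ≡⟨ cong (x Q.*_) (ι-* s c) ⟩
      x Q.* (ι s Q.* ι c)             ≡⟨ reassoc x (ι s) (ι c) ⟩
      x Q.* ι c Q.* ι s               ≡⟨ cong (Q._* ι s) x*c≡δ+k ⟩
      (δ Q.+ ιₙ k) Q.* ι s            ≡⟨ distrib δ (ιₙ k) (ι s) ⟩
      ι s Q.* δ Q.+ ιₙ k Q.* ι s      ≡⟨ cong₂ Q._+_ s*δ≡t (sym (ι-* (+ k) s)) ⟩
      ι t Q.+ ι (+ k Z.* s)           ≡⟨ ι-+ t (+ k Z.* s) ⟨
      ι (t Z.+ + k Z.* s)             ∎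
      where
      reassoc : ∀ x s c → x Q.* (s Q.* c) ≡ x Q.* c Q.* s
      reassoc = solve 3 (λ x s c → x :* (s :* c) := x :* c :* s) refl
      distrib : ∀ δ k s → (δ Q.+ k) Q.* s ≡ s Q.* δ Q.+ k Q.* s
      distrib = solve 3 (λ δ k s → (δ :+ k) :* s := s :* δ :+ k :* s) refl
    c*m*x-α≡j+m*k : ι (c Z.* + m) Q.* x Q.- α ≡ ι (+ j Z.+ + m Z.* + k)
    c*m*x-α≡j+m*k = begin
      ι (c Z.* + m) Q.* x Q.- α            ≡⟨ cong (λ w → w Q.* x Q.- α) (ι-* c (+ m)) ⟩
      ι c Q.* ιₙ m Q.* x Q.- α             ≡⟨ cong (Q._- α) (reassoc (ι c) (ιₙ m) x) ⟩
      ιₙ m Q.* (x Q.* ι c) Q.- α           ≡⟨ cong (λ w → ιₙ m Q.* w Q.- α) x*c≡δ+k ⟩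
      ιₙ m Q.* (δ Q.+ ιₙ k) Q.- α          ≡⟨ regroup (ιₙ m) δ (ιₙ k) α ⟩
      (ιₙ m Q.* δ Q.- α) Q.+ ιₙ m Q.* ιₙ k ≡⟨ cong₂ Q._+_ m*δ-α≡j (sym (ι-* (+ m) (+ k))) ⟩
      ιₙ j Q.+ ι (+ m Z.* + k)             ≡⟨ ι-+ (+ j) (+ m Z.* + k) ⟨
      ι (+ j Z.+ + m Z.* + k)              ∎
      where
      reassoc : ∀ c m x → c Q.* m Q.* x ≡ m Q.* (x Q.* c)
      reassoc = solve 3 (λ c m x → c :* m :* x := m :* (x :* c)) refl
      regroup : ∀ m δ k α → m Q.* (δ Q.+ k) Q.- α ≡ (m Q.* δ Q.- α) Q.+ m Q.* k
      regroup = solve 4 (λ m δ k α → m :* (δ :+ k) :- α := (m :* δ :- α) :+ m :* k) refl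

integral-∣ : ∀ x {s d} → s ZS.∣ d → Integral (x Q.* ι s) → Integral (x Q.* ι d)
integral-∣ x {s} {d} s∣d (z , x*s≡z) = z Z.* q , (begin
  x Q.* ι d            ≡⟨ cong (λ w → x Q.* ι w) (ZS._∣_.equality s∣d) ⟩
  x Q.* ι (q Z.* s)    ≡⟨ cong (x Q.*_) (ι-* q s) ⟩
  x Q.* (ι q Q.* ι s)  ≡⟨ reassoc x (ι q) (ι s) ⟩
  x Q.* ι s Q.* ι q    ≡⟨ cong (Q._* ι q) x*s≡z ⟩
  ι z Q.* ι q          ≡⟨ ι-* z q ⟨
  ι (z Z.* q)          ∎)
  where
  open ≡-Reasoning
  q : ℤ
  q = ZS._∣_.quotient s∣d
  reassoc : ∀ x q s → x Q.* (q Q.* s) ≡ x Q.* s Q.* q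
  reassoc = solve 3 (λ x q s → x :* (q :* s) := x :* s :* q) refl

admissible-∣ : ∀ {b s d α x} → s ZS.∣ d → Admissible b s α x → Admissible b d α x
admissible-∣ {x = x} s∣d A = record
  { 0<x = 0<x ; x≤1 = x≤1 ; x*s-integral = integral-∣ x s∣d x*s-integral ; b*x-α-integral = b*x-α-integral }
  where open Admissible A

i≤+∣i∣ : ∀ i → i Z.≤ + ∣ i ∣
i≤+∣i∣ (+ n)    = ZP.≤-refl
i≤+∣i∣ -[1+ n ] = Z.-≤+

i<j⇒1≤j-i : ∀ {i j} → i Z.< j → + 1 Z.≤ j Z.- i
i<j⇒1≤j-i {i} {j} i<j = subst (Z._≤ j Z.- i) (cancel i) (ZP.+-monoˡ-≤ (Z.- i) (ZP.i<j⇒suc[i]≤j i<j))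
  where
  cancel : ∀ i → + 1 Z.+ i Z.- i ≡ + 1
  cancel = solve-∀

0<⇒≢0 : ∀ {i} → + 0 Z.< i → i ≢ + 0
0<⇒≢0 0<i i≡0 = ZP.<⇒≢ 0<i (sym i≡0)

d*[f-f′]<b*[z′-z] : ∀ {b d f f′ z z′} → + 0 Z.< b → + 0 Z.< d →
  d Z.* + ∣ f Z.- f′ ∣ Z.< b → z Z.< z′ → d Z.* (f Z.- f′) Z.< b Z.* (z′ Z.- z)
d*[f-f′]<b*[z′-z] {b} {d} {f} {f′} {z} {z′} 0<b 0<d gap z<z′ = begin-strict
  d Z.* (f Z.- f′)          ≤⟨ ZP.*-monoˡ-≤-nonNeg d {{Z.nonNegative (ZP.<⇒≤ 0<d)}} (i≤+∣i∣ (f Z.- f′)) ⟩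
  d Z.* + ∣ f Z.- f′ ∣      <⟨ gap ⟩
  b                         ≡⟨ ZP.*-identityʳ b ⟨
  b Z.* + 1                 ≤⟨ ZP.*-monoˡ-≤-nonNeg b {{Z.nonNegative (ZP.<⇒≤ 0<b)}} (i<j⇒1≤j-i z<z′) ⟩
  b Z.* (z′ Z.- z)          ∎
  where open ZP.≤-Reasoning

-- Multiplying by b·d, the gap of at least 1/d between x and x′ outweighs |u - u′| = |f - f′|/b < 1/d.
x<x′⇒x+u<x′+u′ : ∀ {b d x x′ u u′ f f′} → + 0 Z.< b → + 0 Z.< d →
  u Q.* ι b ≡ ι f → u′ Q.* ι b ≡ ι f′ → Integral (x Q.* ι d) → Integral (x′ Q.* ι d) →
  d Z.* + ∣ f Z.- f′ ∣ Z.< b → x Q.< x′ → x Q.+ u Q.< x′ Q.+ u′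
x<x′⇒x+u<x′+u′ {b} {d} {x} {x′} {u} {u′} {f} {f′} 0<b 0<d u*b≡f u′*b≡f′ (z , x*d≡z) (z′ , x′*d≡z′) gap x<x′ =
  diff-pos (QP.*-cancelʳ-<-nonNeg (ι b Q.* ι d) {{Q.nonNegative 0≤b*d}}
    (subst₂ Q._<_ (sym (QP.*-zeroˡ (ι b Q.* ι d))) (sym diff*b*d≡K) (ι-mono-< 0<K)))
  where
  0<dℚ : Q.0ℚ Q.< ι d
  0<dℚ = ι-mono-< {+ 0} {d} 0<d
  0≤b*d : Q.0ℚ Q.≤ ι b Q.* ι d
  0≤b*d = subst (Q._≤ ι b Q.* ι d) (QP.*-zeroˡ (ι d))
            (QP.*-monoʳ-≤-nonNeg (ι d) {{Q.nonNegative (QP.<⇒≤ 0<dℚ)}} (ι-mono-≤ {+ 0} {b} (ZP.<⇒≤ 0<b)))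
  z<z′ : z Z.< z′
  z<z′ = ι-cancel-< (subst₂ Q._<_ x*d≡z x′*d≡z′ (QP.*-monoˡ-<-pos (ι d) {{Q.positive 0<dℚ}} x<x′))
  K : ℤ
  K = b Z.* (z′ Z.- z) Z.- d Z.* (f Z.- f′)
  0<K : + 0 Z.< K
  0<K = ZP.suc[i]≤j⇒i<j (i<j⇒1≤j-i (d*[f-f′]<b*[z′-z] {f = f} {f′} 0<b 0<d gap z<z′))
  diff*b*d≡K : ((x′ Q.+ u′) Q.- (x Q.+ u)) Q.* (ι b Q.* ι d) ≡ ι K
  diff*b*d≡K = begin
    ((x′ Q.+ u′) Q.- (x Q.+ u)) Q.* (ι b Q.* ι d)
      ≡⟨ expand x x′ u u′ (ι b) (ι d) ⟩
    ι b Q.* (x′ Q.* ι d) Q.- ι b Q.* (x Q.* ι d) Q.+ (ι d Q.* (u′ Q.* ι b) Q.- ι d Q.* (u Q.* ι b))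
      ≡⟨ cong₂ (λ p q → ι b Q.* p Q.- ι b Q.* q Q.+ (ι d Q.* (u′ Q.* ι b) Q.- ι d Q.* (u Q.* ι b))) x′*d≡z′ x*d≡z ⟩
    ι b Q.* ι z′ Q.- ι b Q.* ι z Q.+ (ι d Q.* (u′ Q.* ι b) Q.- ι d Q.* (u Q.* ι b))
      ≡⟨ cong₂ (λ p q → ι b Q.* ι z′ Q.- ι b Q.* ι z Q.+ (ι d Q.* p Q.- ι d Q.* q)) u′*b≡f′ u*b≡f ⟩
    ι b Q.* ι z′ Q.- ι b Q.* ι z Q.+ (ι d Q.* ι f′ Q.- ι d Q.* ι f)
      ≡⟨ collect (ι b) (ι z′) (ι z) (ι d) (ι f′) (ι f) ⟩
    ι b Q.* (ι z′ Q.- ι z) Q.- ι d Q.* (ι f Q.- ι f′)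
      ≡⟨ cong₂ Q._-_ (trans (ι-* b (z′ Z.- z)) (cong (ι b Q.*_) (ι-minus z′ z)))
                     (trans (ι-* d (f Z.- f′)) (cong (ι d Q.*_) (ι-minus f f′))) ⟨
    ι (b Z.* (z′ Z.- z)) Q.- ι (d Z.* (f Z.- f′))
      ≡⟨ ι-minus (b Z.* (z′ Z.- z)) (d Z.* (f Z.- f′)) ⟨
    ι K ∎
    where
    open ≡-Reasoning
    expand : ∀ x x′ u u′ b d → ((x′ Q.+ u′) Q.- (x Q.+ u)) Q.* (b Q.* d) ≡
      b Q.* (x′ Q.* d) Q.- b Q.* (x Q.* d) Q.+ (d Q.* (u′ Q.* b) Q.- d Q.* (u Q.* b))
    expand = solve 6 (λ x x′ u u′ b d → ((x′ :+ u′) :- (x :+ u)) :* (b :* d) :=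
      b :* (x′ :* d) :- b :* (x :* d) :+ (d :* (u′ :* b) :- d :* (u :* b))) refl
    collect : ∀ b z′ z d f′ f → b Q.* z′ Q.- b Q.* z Q.+ (d Q.* f′ Q.- d Q.* f) ≡ b Q.* (z′ Q.- z) Q.- d Q.* (f Q.- f′)
    collect = solve 6 (λ b z′ z d f′ f → b :* z′ :- b :* z :+ (d :* f′ :- d :* f) := b :* (z′ :- z) :- d :* (f :- f′)) refl
  diff-pos : Q.0ℚ Q.< (x′ Q.+ u′) Q.- (x Q.+ u) → x Q.+ u Q.< x′ Q.+ u′
  diff-pos lt = subst₂ Q._<_ (QP.+-identityʳ (x Q.+ u)) (cancel (x Q.+ u) (x′ Q.+ u′)) (QP.+-monoʳ-< (x Q.+ u) lt)
    where
    cancel : ∀ p q → p Q.+ (q Q.- p) ≡ q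
    cancel = solve 2 (λ p q → p :+ (q :- p) := q) refl

floor-minus-ι : ∀ q n → floor (q Q.- ι n) ≡ floor q Z.- n
floor-minus-ι q n = trans (cong (λ w → floor (q Q.+ w)) (sym (ι-neg n))) (floor-+ι q (Z.- n))

÷ℤ-mono-≤⇔ : ∀ {b} f g → + 0 Z.< b → (ι f ÷ℤ b Q.≤ ι g ÷ℤ b) ⇔ (f Z.≤ g)
÷ℤ-mono-≤⇔ {b} f g 0<b = mk⇔
  (λ le → ι-cancel-≤ (subst₂ Q._≤_ (÷ℤ-*-cancel (ι f) b b≢0) (÷ℤ-*-cancel (ι g) b b≢0)
            (QP.*-monoʳ-≤-nonNeg (ι b) {{Q.nonNegative (QP.<⇒≤ 0<bℚ)}} le)))
  (λ le → QP.*-cancelʳ-≤-pos (ι b) {{Q.positive 0<bℚ}}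
            (subst₂ Q._≤_ (sym (÷ℤ-*-cancel (ι f) b b≢0)) (sym (÷ℤ-*-cancel (ι g) b b≢0)) (ι-mono-≤ le)))
  where
  b≢0 : b ≢ + 0
  b≢0 = 0<⇒≢0 0<b
  0<bℚ : Q.0ℚ Q.< ι b
  0<bℚ = ι-mono-< {+ 0} {b} 0<b

+-cancelˡ-≤ : ∀ x {p q} → x Q.+ p Q.≤ x Q.+ q → p Q.≤ q
+-cancelˡ-≤ x {p} {q} le = subst₂ Q._≤_ (cancel x p) (cancel x q) (QP.+-monoʳ-≤ (Q.- x) le)
  where
  cancel : ∀ x p → Q.- x Q.+ (x Q.+ p) ≡ p
  cancel = solve 2 (λ x p → :- x :+ (x :+ p) := p) refl

x+p≤x+q⇔p≤q : ∀ x p q → (x Q.+ p Q.≤ x Q.+ q) ⇔ (p Q.≤ q)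
x+p≤x+q⇔p≤q x p q = mk⇔ (+-cancelˡ-≤ x) (QP.+-monoʳ-≤ x)

x-ιF≤x-ιG⇔G≤F : ∀ x F G → (x Q.- ι F Q.≤ x Q.- ι G) ⇔ (G Z.≤ F)
x-ιF≤x-ιG⇔G≤F x F G = mk⇔
  (λ le → ZP.neg-cancel-≤ (ι-cancel-≤ (subst₂ Q._≤_ (sym (ι-neg F)) (sym (ι-neg G)) (+-cancelˡ-≤ x le))))
  (λ le → QP.+-monoʳ-≤ x (QP.neg-antimono-≤ (ι-mono-≤ le)))

i-j≤i⇔0≤j : ∀ i j → (i Z.- j Z.≤ i) ⇔ (+ 0 Z.≤ j)
i-j≤i⇔0≤j i j = mk⇔
  (λ le → subst (+ 0 Z.≤_) (cancel i j) (ZP.i≤j⇒0≤j-i le))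
  (λ 0≤j → ZP.i-j≤i i j {{Z.nonNegative 0≤j}})
  where
  cancel : ∀ i j → i Z.- (i Z.- j) ≡ j
  cancel = solve-∀

0≤a*n⇔0≤n : ∀ {a} n → + 0 Z.< a → (+ 0 Z.≤ a Z.* n) ⇔ (+ 0 Z.≤ n)
0≤a*n⇔0≤n {a} n 0<a = mk⇔
  (λ le → ZP.*-cancelˡ-≤-pos (+ 0) n a {{Z.positive 0<a}} (subst (Z._≤ a Z.* n) (sym (ZP.*-zeroʳ a)) le))
  (λ le → subst (Z._≤ a Z.* n) (ZP.*-zeroʳ a) (ZP.*-monoˡ-≤-nonNeg a {{Z.nonNegative (ZP.<⇒≤ 0<a)}} le))

module Comparison {b d a : ℤ} (0<b : + 0 Z.< b) (0<d : + 0 Z.< d) (0<a : + 0 Z.< a)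
                  {α₁ α₂ x₁ x₂ : ℚ} (A₁ : Admissible b d α₁ x₁) (A₂ : Admissible b d α₂ x₂)
                  (gap : d Z.* + ∣ floor (Q.1ℚ Q.- α₁) Z.- floor (Q.1ℚ Q.- α₂) ∣ Z.< b) where

  private
    module A₁ = Admissible A₁
    module A₂ = Admissible A₂

  f₁ f₂ F₁ F₂ : ℤ
  f₁ = floor (Q.1ℚ Q.- α₁)
  f₂ = floor (Q.1ℚ Q.- α₂)
  F₁ = floor (Q.1ℚ Q.- ι a Q.* α₁)
  F₂ = floor (Q.1ℚ Q.- ι a Q.* α₂)

  γ₁ γ₂ Γ₁ Γ₂ : ℚ
  γ₁ = x₁ Q.+ (ι f₁ ÷ℤ b)
  γ₂ = x₂ Q.+ (ι f₂ ÷ℤ b)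
  Γ₁ = x₁ Q.- ι F₁
  Γ₂ = x₂ Q.- ι F₂

  ⟨Γ₁⟩≡x₁ : ⟨ Γ₁ ⟩ ≡ x₁
  ⟨Γ₁⟩≡x₁ = ⟨-ι⟩ x₁ F₁ A₁.0<x A₁.x≤1

  ⟨Γ₂⟩≡x₂ : ⟨ Γ₂ ⟩ ≡ x₂
  ⟨Γ₂⟩≡x₂ = ⟨-ι⟩ x₂ F₂ A₂.0<x A₂.x≤1

  f÷b*b≡f : ∀ f → (ι f ÷ℤ b) Q.* ι b ≡ ι f
  f÷b*b≡f f = ÷ℤ-*-cancel (ι f) b (0<⇒≢0 0<b)

  x₁<x₂⇒γ₁<γ₂ : x₁ Q.< x₂ → γ₁ Q.< γ₂
  x₁<x₂⇒γ₁<γ₂ = x<x′⇒x+u<x′+u′ {f = f₁} {f₂} 0<b 0<d (f÷b*b≡f f₁) (f÷b*b≡f f₂) A₁.x*s-integral A₂.x*s-integral gap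

  x₂<x₁⇒γ₂<γ₁ : x₂ Q.< x₁ → γ₂ Q.< γ₁
  x₂<x₁⇒γ₂<γ₁ = x<x′⇒x+u<x′+u′ {f = f₂} {f₁} 0<b 0<d (f÷b*b≡f f₂) (f÷b*b≡f f₁) A₂.x*s-integral A₁.x*s-integral
                  (subst (λ n → d Z.* + n Z.< b) (ZP.∣i-j∣≡∣j-i∣ f₁ f₂) gap)

  module Tie (x₁≡x₂ : x₁ ≡ x₂) where

    n₁ n₂ N : ℤ
    n₁ = proj₁ A₁.b*x-α-integral
    n₂ = proj₁ A₂.b*x-α-integral
    N  = n₂ Z.- n₁

    α₁≡α₂+N : α₁ ≡ α₂ Q.+ ι N
    α₁≡α₂+N = begin
      α₁                                  ≡⟨ cancel y α₁ ⟨
      y Q.- (y Q.- α₁)                    ≡⟨ cong (λ w → y Q.- w) b*x₂-α₁≡n₁ ⟩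
      y Q.- ι n₁                          ≡⟨ regroup y (ι n₁) (ι n₂) ⟩
      (y Q.- ι n₂) Q.+ (ι n₂ Q.- ι n₁)    ≡⟨ cong₂ Q._+_ (cong (λ w → y Q.- w) (sym (proj₂ A₂.b*x-α-integral)))
                                                          (sym (ι-minus n₂ n₁)) ⟩
      (y Q.- (y Q.- α₂)) Q.+ ι N          ≡⟨ cong (Q._+ ι N) (cancel y α₂) ⟩
      α₂ Q.+ ι N                          ∎
      where
      open ≡-Reasoning
      y : ℚ
      y = ι b Q.* x₂
      b*x₂-α₁≡n₁ : y Q.- α₁ ≡ ι n₁
      b*x₂-α₁≡n₁ = subst (λ x → ι b Q.* x Q.- α₁ ≡ ι n₁) x₁≡x₂ (proj₂ A₁.b*x-α-integral)
      cancel : ∀ y α → y Q.- (y Q.- α) ≡ α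
      cancel = solve 2 (λ y α → y :- (y :- α) := α) refl
      regroup : ∀ y p q → y Q.- p ≡ (y Q.- q) Q.+ (q Q.- p)
      regroup = solve 3 (λ y p q → y :- p := (y :- q) :+ (q :- p)) refl

    f₁≡f₂-N : f₁ ≡ f₂ Z.- N
    f₁≡f₂-N = trans (cong (λ α → floor (Q.1ℚ Q.- α)) α₁≡α₂+N)
                (trans (cong floor (regroup Q.1ℚ α₂ (ι N))) (floor-minus-ι (Q.1ℚ Q.- α₂) N))
      where
      regroup : ∀ o α n → o Q.- (α Q.+ n) ≡ o Q.- α Q.- n
      regroup = solve 3 (λ o α n → o :- (α :+ n) := o :- α :- n) refl

    F₁≡F₂-aN : F₁ ≡ F₂ Z.- a Z.* N
    F₁≡F₂-aN = trans (cong (λ α → floor (Q.1ℚ Q.- ι a Q.* α)) α₁≡α₂+N)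
                 (trans (cong floor (trans (regroup Q.1ℚ (ι a) α₂ (ι N)) (cong (λ w → Q.1ℚ Q.- ι a Q.* α₂ Q.- w) (sym (ι-* a N)))))
                        (floor-minus-ι (Q.1ℚ Q.- ι a Q.* α₂) (a Z.* N)))
      where
      regroup : ∀ o a α n → o Q.- a Q.* (α Q.+ n) ≡ o Q.- a Q.* α Q.- a Q.* n
      regroup = solve 4 (λ o a α n → o :- a :* (α :+ n) := o :- a :* α :- a :* n) refl

    γ₁≤γ₂⇔0≤N : (γ₁ Q.≤ γ₂) ⇔ (+ 0 Z.≤ N)
    γ₁≤γ₂⇔0≤N =
      ⇔.trans (subst (λ x → (x Q.+ (ι f₁ ÷ℤ b) Q.≤ γ₂) ⇔ (ι f₁ ÷ℤ b Q.≤ ι f₂ ÷ℤ b)) (sym x₁≡x₂)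
                     (x+p≤x+q⇔p≤q x₂ (ι f₁ ÷ℤ b) (ι f₂ ÷ℤ b)))
      (⇔.trans (÷ℤ-mono-≤⇔ f₁ f₂ 0<b)
               (subst (λ f → (f Z.≤ f₂) ⇔ (+ 0 Z.≤ N)) (sym f₁≡f₂-N) (i-j≤i⇔0≤j f₂ N)))

    Γ₂≤Γ₁⇔0≤N : (Γ₂ Q.≤ Γ₁) ⇔ (+ 0 Z.≤ N)
    Γ₂≤Γ₁⇔0≤N =
      ⇔.trans (subst (λ x → (Γ₂ Q.≤ x Q.- ι F₁) ⇔ (F₁ Z.≤ F₂)) (sym x₁≡x₂) (x-ιF≤x-ιG⇔G≤F x₂ F₂ F₁))
      (⇔.trans (subst (λ F → (F Z.≤ F₂) ⇔ (+ 0 Z.≤ a Z.* N)) (sym F₁≡F₂-aN) (i-j≤i⇔0≤j F₂ (a Z.* N)))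
               (0≤a*n⇔0≤n N 0<a))

    Γ₁≡Γ₂⇒α₁≡α₂ : Γ₁ ≡ Γ₂ → α₁ ≡ α₂
    Γ₁≡Γ₂⇒α₁≡α₂ Γ₁≡Γ₂ = trans α₁≡α₂+N (trans (cong (λ n → α₂ Q.+ ι n) N≡0) (QP.+-identityʳ α₂))
      where
      cancel : ∀ x y → x Q.- (x Q.- y) ≡ y
      cancel = solve 2 (λ x y → x :- (x :- y) := y) refl
      F₁≡F₂ : F₁ ≡ F₂
      F₁≡F₂ = ι-injective (trans (sym (cancel x₁ (ι F₁))) (trans (cong₂ Q._-_ x₁≡x₂ Γ₁≡Γ₂) (cancel x₂ (ι F₂))))
      a*N≡0 : a Z.* N ≡ + 0
      a*N≡0 = trans (cancelℤ F₂ (a Z.* N)) (trans (cong (λ w → F₂ Z.- w) (trans (sym F₁≡F₂-aN) F₁≡F₂)) (ZP.+-inverseʳ F₂))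
        where
        cancelℤ : ∀ i j → j ≡ i Z.- (i Z.- j)
        cancelℤ = solve-∀
      N≡0 : N ≡ + 0
      N≡0 = ZP.*-cancelˡ-≡ a N (+ 0) {{Z.≢-nonZero (0<⇒≢0 0<a)}} (trans a*N≡0 (sym (ZP.*-zeroʳ a)))

  γ₁≤γ₂⇔Γ₁≼Γ₂ : (γ₁ Q.≤ γ₂) ⇔ (Γ₁ ≼ Γ₂)
  γ₁≤γ₂⇔Γ₁≼Γ₂ = mk⇔ ⇒≼ ≼⇒
    where
    ⇒≼ : γ₁ Q.≤ γ₂ → Γ₁ ≼ Γ₂
    ⇒≼ γ₁≤γ₂ with QP.<-cmp x₁ x₂
    ... | tri< x₁<x₂ _ _ = inj₁ (subst₂ Q._<_ (sym ⟨Γ₁⟩≡x₁) (sym ⟨Γ₂⟩≡x₂) x₁<x₂)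
    ... | tri≈ _ x₁≡x₂ _ = inj₂ (trans ⟨Γ₁⟩≡x₁ (trans x₁≡x₂ (sym ⟨Γ₂⟩≡x₂)) ,
                                 Equivalence.from Γ₂≤Γ₁⇔0≤N (Equivalence.to γ₁≤γ₂⇔0≤N γ₁≤γ₂))
      where open Tie x₁≡x₂
    ... | tri> _ _ x₂<x₁ = ⊥-elim (QP.<-irrefl refl (QP.<-≤-trans (x₂<x₁⇒γ₂<γ₁ x₂<x₁) γ₁≤γ₂))
    ≼⇒ : Γ₁ ≼ Γ₂ → γ₁ Q.≤ γ₂
    ≼⇒ (inj₁ ⟨Γ₁⟩<⟨Γ₂⟩)         = QP.<⇒≤ (x₁<x₂⇒γ₁<γ₂ (subst₂ Q._<_ ⟨Γ₁⟩≡x₁ ⟨Γ₂⟩≡x₂ ⟨Γ₁⟩<⟨Γ₂⟩))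
    ≼⇒ (inj₂ (⟨Γ₁⟩≡⟨Γ₂⟩ , Γ₂≤Γ₁)) = Equivalence.from γ₁≤γ₂⇔0≤N (Equivalence.to Γ₂≤Γ₁⇔0≤N Γ₂≤Γ₁)
      where open Tie (trans (sym ⟨Γ₁⟩≡x₁) (trans ⟨Γ₁⟩≡⟨Γ₂⟩ ⟨Γ₂⟩≡x₂))

  Γ₁≡Γ₂⇒α₁≡α₂ : Γ₁ ≡ Γ₂ → α₁ ≡ α₂
  Γ₁≡Γ₂⇒α₁≡α₂ Γ₁≡Γ₂ = Tie.Γ₁≡Γ₂⇒α₁≡α₂ (trans (sym ⟨Γ₁⟩≡x₁) (trans (cong ⟨_⟩ Γ₁≡Γ₂) ⟨Γ₂⟩≡x₂)) Γ₁≡Γ₂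

shifted-D-admissible : ∀ {r s e δ} c' m' k → s ≢ + 0 → ¬ NonPosInt (r // s) →
  + ∣ r ∣ Z.< + suc c' Z.* + suc m' → + suc c' ZS.∣ r → + suc c' ZS.∣ s →
  s ZS.∣ (+ suc c' Z.* + suc m' Z.* e Z.- + suc c') → k N.< suc c' → IsD (suc m') (r // s) δ →
  (⟨ ι e Q.* (r // s) ⟩ ≡ δ) × Admissible (+ suc c' Z.* + suc m') s (r // s) ((δ Q.+ ιₙ k) ÷ℤ (+ suc c'))
shifted-D-admissible {r} {s} {e} {δ} c' m' k s≢0 α∉ℤ≤0 |r|<c*m c∣r c∣s s∣b*e-c k<c δ≡D[α] =
  ⟨e*α⟩≡δ e s′∣m*e-1 , subst (λ w → Admissible (c Z.* m) w α x) (sym s≡s′*c) (shifted-admissible c' k k<c)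
  where
  c m : ℤ
  c = + suc c'
  m = + suc m'
  α : ℚ
  α = r // s
  x : ℚ
  x = (δ Q.+ ιₙ k) ÷ℤ c
  r′ s′ : ℤ
  r′ = ZS._∣_.quotient c∣r
  s′ = ZS._∣_.quotient c∣s
  r≡r′*c : r ≡ r′ Z.* c
  r≡r′*c = ZS._∣_.equality c∣r
  s≡s′*c : s ≡ s′ Z.* c
  s≡s′*c = ZS._∣_.equality c∣s
  s′≢0 : s′ ≢ + 0
  s′≢0 s′≡0 = s≢0 (trans s≡s′*c (cong (Z._* c) s′≡0))
  α*s′≡r′ : α Q.* ι s′ ≡ ι r′
  α*s′≡r′ = *ι-cancel c (λ ()) (begin
    α Q.* ι s′ Q.* ι c     ≡⟨ QP.*-assoc α (ι s′) (ι c) ⟩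
    α Q.* (ι s′ Q.* ι c)   ≡⟨ cong (α Q.*_) (trans (sym (ι-* s′ c)) (cong ι (sym s≡s′*c))) ⟩
    α Q.* ι s              ≡⟨ ÷ℤ-*-cancel (ι r) s s≢0 ⟩
    ι r                    ≡⟨ trans (cong ι r≡r′*c) (ι-* r′ c) ⟩
    ι r′ Q.* ι c           ∎)
    where open ≡-Reasoning
  |r′|<m : + ∣ r′ ∣ Z.< m
  |r′|<m = Z.+<+ (NP.*-cancelʳ-< (suc c') ∣ r′ ∣ (suc m')
             (subst₂ N._<_ (trans (cong ∣_∣ r≡r′*c) (ZP.abs-* r′ c)) (trans (ZP.abs-* c m) (NP.*-comm (suc c') (suc m')))
                     (ZP.drop‿+<+ |r|<c*m)))
  s′∣m*e-1 : s′ ZS.∣ (m Z.* e Z.- + 1)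
  s′∣m*e-1 = ZS.*-cancelʳ-∣ c (subst₂ ZS._∣_ s≡s′*c (factor c m e) s∣b*e-c)
    where
    factor : ∀ c m e → c Z.* m Z.* e Z.- c ≡ (m Z.* e Z.- + 1) Z.* c
    factor = solve-∀
  open D-analysis m' {r = r′} s′≢0 α*s′≡r′ |r′|<m α∉ℤ≤0 δ≡D[α] using (⟨e*α⟩≡δ; shifted-admissible)

index-analysis : ∀ {r s} → s ≢ + 0 → ¬ NonPosInt (r // s) → ∀ {b} → + ∣ r ∣ Z.< b →
  ∀ {c} → c ∣ r → c ∣ s → c ∣ b → ∀ {e} → s ∣ (b Z.* e Z.- c) → ∀ {k} → + k Z.< c →
  ∀ {δ} → IsD (∣ b ∣ quot ∣ c ∣) (r // s) δ →
  (⟨ ι e Q.* (r // s) ⟩ ≡ δ) × Admissible b s (r // s) ((δ Q.+ ιₙ k) ÷ℤ c)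
index-analysis _ _ {+ zero} (Z.+<+ ()) _ _ _ _ _ _
index-analysis _ _ {+ suc _} _ {+ zero} _ _ _ _ (Z.+<+ ()) _
index-analysis _ _ {+ suc _} _ { -[1+ _ ]} _ _ _ _ () _
index-analysis {r} {s} s≢0 α∉ℤ≤0 {+ suc B'} |r|<b {+ suc c'} c∣r c∣s c∣b {e} s∣b*e-c {k} (Z.+<+ k<c) {δ} δ≡D[α]
  with suc B' NDM./ suc c' | NDM.m*[n/m]≡n {suc c'} {suc B'} c∣b
... | zero   | c*0≡b = ⊥-elim (NP.0≢1+n (trans (sym (NP.*-zeroʳ (suc c'))) c*0≡b))
... | suc m' | c*m≡b =
  subst (λ b → (⟨ ι e Q.* (r // s) ⟩ ≡ δ) × Admissible b s (r // s) ((δ Q.+ ιₙ k) ÷ℤ (+ suc c'))) (sym b≡c*m)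
    (shifted-D-admissible {r} {s} {e} {δ} c' m' k s≢0 α∉ℤ≤0 (subst (+ ∣ r ∣ Z.<_) b≡c*m |r|<b) (ZS.∣ᵤ⇒∣ c∣r) (ZS.∣ᵤ⇒∣ c∣s)
      (subst (λ b → s ZS.∣ (b Z.* e Z.- + suc c')) b≡c*m (ZS.∣ᵤ⇒∣ s∣b*e-c)) k<c δ≡D[α])
  where
  b≡c*m : + suc B' ≡ + suc c' Z.* + suc m'
  b≡c*m = trans (cong +_ (sym c*m≡b)) (ZP.pos-* (suc c') (suc m'))

gcd-index-analysis : ∀ r s b → s ≢ + 0 → ¬ NonPosInt (r // s) → + ∣ r ∣ Z.< b →
  let c = gcd (gcd r s) b in ∀ {e} → s ∣ (b Z.* e Z.- c) → ∀ {k} → + k Z.< c →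
  ∀ {δ} → IsD (∣ b ∣ quot ∣ c ∣) (r // s) δ →
  (⟨ ι e Q.* (r // s) ⟩ ≡ δ) × Admissible b s (r // s) ((δ Q.+ ιₙ k) ÷ℤ c)
gcd-index-analysis r s b s≢0 α∉ℤ≤0 |r|<b = index-analysis {r} {s} s≢0 α∉ℤ≤0 |r|<b
  (ND.∣-trans (gcd[i,j]∣i (gcd r s) b) (gcd[i,j]∣i r s))
  (ND.∣-trans (gcd[i,j]∣i (gcd r s) b) (gcd[i,j]∣j r s))
  (gcd[i,j]∣j (gcd r s) b)

0<lcm : ∀ {i j} → i ≢ + 0 → j ≢ + 0 → + 0 Z.< lcm i j
0<lcm {i} {j} i≢0 j≢0 = Z.+<+ (NP.n≢0⇒n>0 lcm≢0)
  where
  lcm≢0 : NL.lcm ∣ i ∣ ∣ j ∣ ≢ 0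
  lcm≢0 lcm≡0 with NP.m*n≡0⇒m≡0∨n≡0 ∣ i ∣ (trans (sym (NL.gcd*lcm ∣ i ∣ ∣ j ∣))
                     (trans (cong (NG.gcd ∣ i ∣ ∣ j ∣ N.*_) lcm≡0) (NP.*-zeroʳ (NG.gcd ∣ i ∣ ∣ j ∣))))
  ... | inj₁ ∣i∣≡0 = i≢0 (ZP.∣i∣≡0⇒i≡0 ∣i∣≡0)
  ... | inj₂ ∣j∣≡0 = j≢0 (ZP.∣i∣≡0⇒i≡0 ∣j∣≡0)

≼-transport : ∀ {P R : Set} {Γ₁ Γ₂ Γ₁′ Γ₂′ : ℚ} → Γ₁ ≡ Γ₁′ → Γ₂ ≡ Γ₂′ →
  (P ⇔ Γ₁′ ≼ Γ₂′) × (Γ₁′ ≡ Γ₂′ → R) → (P ⇔ Γ₁ ≼ Γ₂) × (Γ₁ ≡ Γ₂ → R)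
≼-transport refl refl result = result

lemma5p2 : (r₁ s₁ r₂ s₂ : ℤ) → s₁ ≢ + 0 → s₂ ≢ + 0 →
  let α₁ = r₁ // s₁
      α₂ = r₂ // s₂
      d = lcm s₁ s₂
  in ¬ NonPosInt α₁ → ¬ NonPosInt α₂ →
  (b : ℤ) →
  + ∣ r₁ ∣ Z.< b → + ∣ r₂ ∣ Z.< b →
  d Z.* + ∣ floor (Q.1ℚ Q.- α₁) Z.- floor (Q.1ℚ Q.- α₂) ∣ Z.< b →
  let c₁ = gcd (gcd r₁ s₁) b
      c₂ = gcd (gcd r₂ s₂) b
  in (e₁ e₂ : ℤ) →
  + 1 Z.≤ e₁ → e₁ Z.≤ d → s₁ ∣ (b Z.* e₁ Z.- c₁) →
  + 1 Z.≤ e₂ → e₂ Z.≤ d → s₂ ∣ (b Z.* e₂ Z.- c₂) →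
  (k₁ k₂ : ℕ) → + k₁ Z.< c₁ → + k₂ Z.< c₂ →
  (a : ℤ) → + 0 Z.< a →
  (δ₁ δ₂ : ℚ) →
  IsD (∣ b ∣ quot ∣ c₁ ∣) α₁ δ₁ → IsD (∣ b ∣ quot ∣ c₂ ∣) α₂ δ₂ →
  let γ₁ = ((δ₁ Q.+ ιₙ k₁) ÷ℤ c₁) Q.+ (ι (floor (Q.1ℚ Q.- α₁)) ÷ℤ b)
      γ₂ = ((δ₂ Q.+ ιₙ k₂) ÷ℤ c₂) Q.+ (ι (floor (Q.1ℚ Q.- α₂)) ÷ℤ b)
      Γ₁ = ((⟨ ι e₁ Q.* α₁ ⟩ Q.+ ιₙ k₁) ÷ℤ c₁) Q.- ι (floor (Q.1ℚ Q.- ι a Q.* α₁))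
      Γ₂ = ((⟨ ι e₂ Q.* α₂ ⟩ Q.+ ιₙ k₂) ÷ℤ c₂) Q.- ι (floor (Q.1ℚ Q.- ι a Q.* α₂))
  in (γ₁ Q.≤ γ₂ ⇔ Γ₁ ≼ Γ₂) × (Γ₁ ≡ Γ₂ → α₁ ≡ α₂)
lemma5p2 r₁ s₁ r₂ s₂ s₁≢0 s₂≢0 α₁∉ℤ≤0 α₂∉ℤ≤0 b |r₁|<b |r₂|<b gap e₁ e₂ _ _ s₁∣b*e₁-c₁ _ _ s₂∣b*e₂-c₂
         k₁ k₂ k₁<c₁ k₂<c₂ a 0<a δ₁ δ₂ δ₁≡D[α₁] δ₂≡D[α₂] =
  ≼-transport (cong (λ y → ((y Q.+ ιₙ k₁) ÷ℤ c₁) Q.- ι F₁) (proj₁ I₁))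
              (cong (λ y → ((y Q.+ ιₙ k₂) ÷ℤ c₂) Q.- ι F₂) (proj₁ I₂))
              (γ₁≤γ₂⇔Γ₁≼Γ₂ , Γ₁≡Γ₂⇒α₁≡α₂)
  where
  c₁ c₂ : ℤ
  c₁ = gcd (gcd r₁ s₁) b
  c₂ = gcd (gcd r₂ s₂) b
  I₁ : (⟨ ι e₁ Q.* (r₁ // s₁) ⟩ ≡ δ₁) × Admissible b s₁ (r₁ // s₁) ((δ₁ Q.+ ιₙ k₁) ÷ℤ c₁)
  I₁ = gcd-index-analysis r₁ s₁ b s₁≢0 α₁∉ℤ≤0 |r₁|<b s₁∣b*e₁-c₁ k₁<c₁ δ₁≡D[α₁]
  I₂ : (⟨ ι e₂ Q.* (r₂ // s₂) ⟩ ≡ δ₂) × Admissible b s₂ (r₂ // s₂) ((δ₂ Q.+ ιₙ k₂) ÷ℤ c₂)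
  I₂ = gcd-index-analysis r₂ s₂ b s₂≢0 α₂∉ℤ≤0 |r₂|<b s₂∣b*e₂-c₂ k₂<c₂ δ₂≡D[α₂]
  0<b : + 0 Z.< b
  0<b = ZP.≤-<-trans (Z.+≤+ N.z≤n) |r₁|<b
  open Comparison 0<b (0<lcm s₁≢0 s₂≢0) 0<a
         (admissible-∣ (ZS.∣ᵤ⇒∣ (i∣lcm[i,j] s₁ s₂)) (proj₂ I₁)) (admissible-∣ (ZS.∣ᵤ⇒∣ (j∣lcm[i,j] s₁ s₂)) (proj₂ I₂)) gap
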